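{- Let $x_1,x_2,x_3,d_1,d_2,d_3,L$ be numbers satisfying the seven factor equations $\tilde p_2=\tilde p_3=\tilde p_4=\tilde p_5=\tilde p_6=\tilde p_7=\tilde p_8=0$ and such that the matrix $N$ has rank $1$. Then $p_1=0$, $p_2=0$, $p_3=0$.
   Context: Define $p_0=x_1^2+x_2^2+x_3^2-L^2$, $p_1=x_2^2+x_3^2-d_1^2$, $p_2=x_3^2+x_1^2-d_2^2$, $p_3=x_1^2+x_2^2-d_3^2$, and $\tilde p_2=p_1+p_2+p_3$, $\tilde p_3=\sum_i d_ip_i$, $\tilde p_4=\sum_i x_ip_i$, $\tilde p_5=\sum_i x_id_ip_i$, $\tilde p_6=\sum_i x_i^2p_i$, $\tilde p_7=\sum_i d_i^2p_i$, $\tilde p_8=\sum_i x_i^2d_i^2p_i$ (sums over $i=1,2,3$). $N$ is the $3\times 7$ matrix whose $i$-th row ($i=1,2,3$) is $(1,\ d_i,\ x_i,\ x_id_i,\ x_i^2,\ d_i^2,\ x_i^2d_i^2)$. -}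

module Defs where

open import Level using (Level; _⊔_) renaming (suc to lsuc)
open import Data.Nat using (ℕ)
import Data.Nat as ℕ
open import Data.Fin using (Fin; zero; suc)
open import Data.Product using (Σ; ∃; ∃₂; _×_; _,_)
open import Relation.Nullary using (¬_)
open import Algebra.Bundles using (CommutativeRing)
import Algebra.Definitions.RawMonoid as RawMonoidDefs

record CharZeroField (c ℓ : Level) : Set (lsuc (c ⊔ ℓ)) where
  field
    commutativeRing : CommutativeRing c ℓ
  open CommutativeRing commutativeRing public
  open RawMonoidDefs +-rawMonoid public using () renaming (_×_ to _·ℕ_)
  field
    1≉0     : ¬ (1# ≈ 0#)
    inverse : ∀ x → ¬ (x ≈ 0#) → ∃ λ y → x * y ≈ 1#
    charZero : ∀ (n : ℕ) → ¬ (ℕ.suc n ·ℕ 1# ≈ 0#)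

module Setup {c ℓ} (F : CharZeroField c ℓ) where
  open CharZeroField F public using (Carrier; _≈_; _+_; _*_; _-_; 0#; 1#)

  sq : Carrier → Carrier
  sq a = a * a

  -- the variables x₁,x₂,x₃,d₁,d₂,d₃ are given as functions Fin 3 → Carrier
  -- (index 0,1,2 ↔ 1,2,3), L is a separate scalar.

  p₀ : (x d : Fin 3 → Carrier) (L : Carrier) → Carrier
  p₀ x d L = sq (x zero) + sq (x (suc zero)) + sq (x (suc (suc zero))) - sq L

  p : (x d : Fin 3 → Carrier) → Fin 3 → Carrier
  p x d zero             = sq (x (suc zero)) + sq (x (suc (suc zero))) - sq (d zero)
  p x d (suc zero)       = sq (x (suc (suc zero))) + sq (x zero) - sq (d (suc zero))
  p x d (suc (suc zero)) = sq (x zero) + sq (x (suc zero)) - sq (d (suc (suc zero)))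

  Σ₃ : (Fin 3 → Carrier) → Carrier
  Σ₃ f = f zero + f (suc zero) + f (suc (suc zero))

  p̃₂ p̃₃ p̃₄ p̃₅ p̃₆ p̃₇ p̃₈ : (x d : Fin 3 → Carrier) → Carrier
  p̃₂ x d = Σ₃ (λ i → p x d i)
  p̃₃ x d = Σ₃ (λ i → d i * p x d i)
  p̃₄ x d = Σ₃ (λ i → x i * p x d i)
  p̃₅ x d = Σ₃ (λ i → x i * d i * p x d i)
  p̃₆ x d = Σ₃ (λ i → sq (x i) * p x d i)
  p̃₇ x d = Σ₃ (λ i → sq (d i) * p x d i)
  p̃₈ x d = Σ₃ (λ i → sq (x i) * sq (d i) * p x d i)

  N : (x d : Fin 3 → Carrier) → Fin 3 → Fin 7 → Carrier
  N x d i zero = 1#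
  N x d i (suc zero) = d i
  N x d i (suc (suc zero)) = x i
  N x d i (suc (suc (suc zero))) = x i * d i
  N x d i (suc (suc (suc (suc zero)))) = sq (x i)
  N x d i (suc (suc (suc (suc (suc zero))))) = sq (d i)
  N x d i (suc (suc (suc (suc (suc (suc zero)))))) = sq (x i) * sq (d i)

  -- Rank exactly 1 (determinantal rank over a field): some entry is nonzero
  -- and every 2×2 minor vanishes.
  HasRankOne : ∀ {m n} → (Fin m → Fin n → Carrier) → Set ℓ
  HasRankOne {m} {n} M =
    (∃₂ λ (i : Fin m) (j : Fin n) → ¬ (M i j ≈ 0#)) ×
    (∀ (i i′ : Fin m) (j j′ : Fin n) → M i j * M i′ j′ ≈ M i j′ * M i′ j)

{-# OPTIONS --safe #-}
-- The first column of N is constantly 1, so the vanishing of the 2×2 minors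
-- through that column forces all rows of N to coincide; in particular
-- x₁ = x₂ = x₃ and d₁ = d₂ = d₃, so p₁ = p₂ = p₃. Then p̃₂ = 3p₁, and in
-- characteristic zero 3 is invertible.
module Submission where

open import Defs
import Data.Nat as ℕ
open import Data.Fin using (Fin; zero; suc)
open import Data.Product using (_,_)
open import Relation.Nullary using (¬_)
import Algebra.Properties.Semiring.Mult as SemiringMult
import Relation.Binary.Reasoning.Setoid as SetoidReasoning

module _ {c ℓ} (F : CharZeroField c ℓ) where
  open CharZeroField F hiding (zero)
  open Setup F using (sq; p; Σ₃; N)
  open SemiringMult semiring using (×-assoc-*; ×-congʳ)
  open SetoidReasoning setoid

  x≉0∧x*y≈0⇒y≈0 : ∀ {x y} → ¬ (x ≈ 0#) → x * y ≈ 0# → y ≈ 0#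
  x≉0∧x*y≈0⇒y≈0 {x} {y} x≉0 xy≈0 with inverse x x≉0
  ... | x⁻¹ , xx⁻¹≈1 = begin
    y              ≈⟨ sym (*-identityˡ y) ⟩
    1# * y         ≈⟨ *-congʳ (trans (sym xx⁻¹≈1) (*-comm x x⁻¹)) ⟩
    x⁻¹ * x * y    ≈⟨ *-assoc x⁻¹ x y ⟩
    x⁻¹ * (x * y)  ≈⟨ *-congˡ xy≈0 ⟩
    x⁻¹ * 0#       ≈⟨ zeroʳ x⁻¹ ⟩
    0#             ∎

  suc·ℕx≈0⇒x≈0 : ∀ n {x} → ℕ.suc n ·ℕ x ≈ 0# → x ≈ 0#
  suc·ℕx≈0⇒x≈0 n {x} nx≈0 = x≉0∧x*y≈0⇒y≈0 (charZero n) (begin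
    (ℕ.suc n ·ℕ 1#) * x  ≈⟨ ×-assoc-* (ℕ.suc n) 1# x ⟩
    ℕ.suc n ·ℕ (1# * x)  ≈⟨ +-cong (*-identityˡ x) (×-congʳ n (*-identityˡ x)) ⟩
    ℕ.suc n ·ℕ x         ≈⟨ nx≈0 ⟩
    0#                   ∎)

  Σ₃-const : ∀ {f a} → (∀ i → f i ≈ a) → Σ₃ f ≈ 3 ·ℕ a
  Σ₃-const {f} {a} f≈a = begin
    f zero + f (suc zero) + f (suc (suc zero))  ≈⟨ +-cong (+-cong (f≈a _) (f≈a _)) (f≈a _) ⟩
    a + a + a                                   ≈⟨ +-assoc a a a ⟩
    a + (a + a)                                 ≈⟨ +-congˡ (+-congˡ (sym (+-identityʳ a))) ⟩
    a + (a + (a + 0#))                          ∎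

  minors-vanish∧unit-column⇒rows-equal :
    ∀ {m n} (M : Fin m → Fin n → Carrier) →
    (∀ i i′ j j′ → M i j * M i′ j′ ≈ M i j′ * M i′ j) →
    ∀ j → (∀ i → M i j ≈ 1#) → ∀ i i′ k → M i k ≈ M i′ k
  minors-vanish∧unit-column⇒rows-equal M minor j unit i i′ k = begin
    M i k             ≈⟨ sym (*-identityʳ (M i k)) ⟩
    M i k * 1#        ≈⟨ *-congˡ (sym (unit i′)) ⟩
    M i k * M i′ j    ≈⟨ sym (minor i i′ j k) ⟩
    M i j * M i′ k    ≈⟨ *-congʳ (unit i) ⟩
    1# * M i′ k       ≈⟨ *-identityˡ (M i′ k) ⟩
    M i′ k            ∎

  sq-cong : ∀ {a b} → a ≈ b → sq a ≈ sq b
  sq-cong a≈b = *-cong a≈b a≈b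

  p-const : ∀ {x d : Fin 3 → Carrier} {a b} →
            (∀ i → x i ≈ a) → (∀ i → d i ≈ b) →
            ∀ i → p x d i ≈ sq a + sq a - sq b
  p-const x≈a d≈b zero =
    +-cong (+-cong (sq-cong (x≈a _)) (sq-cong (x≈a _))) (-‿cong (sq-cong (d≈b _)))
  p-const x≈a d≈b (suc zero) =
    +-cong (+-cong (sq-cong (x≈a _)) (sq-cong (x≈a _))) (-‿cong (sq-cong (d≈b _)))
  p-const x≈a d≈b (suc (suc zero)) =
    +-cong (+-cong (sq-cong (x≈a _)) (sq-cong (x≈a _))) (-‿cong (sq-cong (d≈b _)))

theorem3p1 : ∀ {c ℓ} (F : CharZeroField c ℓ) → let open Setup F in
    ∀ (x d : Fin 3 → Carrier) (L : Carrier) →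
    p̃₂ x d ≈ 0# → p̃₃ x d ≈ 0# → p̃₄ x d ≈ 0# → p̃₅ x d ≈ 0# →
    p̃₆ x d ≈ 0# → p̃₇ x d ≈ 0# → p̃₈ x d ≈ 0# →
    HasRankOne (N x d) →
    ∀ (i : Fin 3) → p x d i ≈ 0#
theorem3p1 F x d _ p̃₂≈0 _ _ _ _ _ _ (_ , minors) i = trans (p≈q i) q≈0
  where
  open CharZeroField F using (Carrier; _≈_; _+_; _-_; 0#; refl; sym; trans)
  open Setup F using (N; p; sq)

  rows-equal : ∀ i i′ k → N x d i k ≈ N x d i′ k
  rows-equal = minors-vanish∧unit-column⇒rows-equal F (N x d) minors zero (λ _ → refl)

  q : Carrier
  q = sq (x zero) + sq (x zero) - sq (d zero)

  p≈q : ∀ i → p x d i ≈ q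
  p≈q = p-const F (λ k → rows-equal k zero (suc (suc zero)))
                  (λ k → rows-equal k zero (suc zero))

  q≈0 : q ≈ 0#
  q≈0 = suc·ℕx≈0⇒x≈0 F 2 (trans (sym (Σ₃-const F p≈q)) p̃₂≈0)
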